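{- In the standing setup of the context, if $G$ has an edge between two small vertices, then every small vertex in $V_2$ is adjacent to some small vertex.
   Context: Loop-free multigraph: finite undirected graph without loops, multiple edges between distinct vertices allowed. The type of an edge joining $u,v$ is $\{u,v\}$; its multiplicity is the number of edges of that type; an edge/type is simple if its multiplicity is one and non-simple if at least two; a graph is simple if all edges are simple. Two vertices are adjacent if there is at least one edge between them. Double edge swap $(a_1,a_2)(a_3,a_4)$: remove two distinct edges of types $\{a_1,a_2\},\{a_3,a_4\}$ and add edges of types $\{a_2,a_3\},\{a_4,a_1\}$; admissible if the removed edges share no endpoint and not both are simple. Orders: fix finite $V$ and $d:V\to\mathbb{N}$, and a total order $<$ on $V$ with $d(u)<d(v)\Rightarrow u<v$. For $u_1>u_2$, $v_1>v_2$ set $\{u_1,u_2\}\le\{v_1,v_2\}$ iff $u_1<v_1$ or ($u_1=v_1$ and $u_2\le v_2$). For loop-free multigraphs on $V$ with degrees $d$: $G'<G$ iff $G$ is not simple and either the maximal non-simple type of $G$ is larger than all non-simple types of $G'$, or the maximal non-simple types of $G'$ and $G$ coincide and its multiplicity is strictly larger in $G$ than in $G'$. Standing setup: $G$ is a non-simple loop-free multigraph on $V$ with $\deg_G v=d(v)$ for all $v$, such that no finite sequence of admissible double edge swaps transforms $G$ into a graph $G'$ with $G'<G$. Let $\{u_1,u_2\}$, $u_1>u_2$, be the maximal non-simple type of $G$. Vertices other than $u_1,u_2$ are ordinary. For $i=1,2$, $V_i$ is the set of ordinary vertices adjacent to $u_i$ and $\overline{V_i}$ the set of ordinary vertices not adjacent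 to $u_i$. An ordinary vertex is small if it is smaller than $u_1$ and large if it is larger than $u_1$. -}

module Defs where

open import Data.Nat using (ℕ; zero; suc; _+_; _≤_; _<_)
open import Data.Fin using (Fin) renaming (_<_ to _<ᶠ_; _≤_ to _≤ᶠ_)
open import Data.Fin.Properties using (_≟_)
open import Data.List using (List; map; allFin)
open import Data.Nat.ListAction using (sum)
open import Data.Product using (Σ; ∃; _×_; _,_)
open import Data.Sum using (_⊎_)
open import Relation.Binary.PropositionalEquality using (_≡_; _≢_)
open import Relation.Nullary using (¬_; yes; no)
open import Relation.Binary.Construct.Closure.ReflexiveTransitive using (Star)

-- Vertex set V = Fin n, totally ordered by the usual order on Fin n
-- (any finite totally ordered set is order-isomorphic to such).

record MGraph (n : ℕ) : Set where
  field
    mult   : Fin n → Fin n → ℕ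
    sym    : ∀ u v → mult u v ≡ mult v u
    noloop : ∀ v → mult v v ≡ 0
open MGraph public

deg : ∀ {n} → MGraph n → Fin n → ℕ
deg {n} G v = sum (map (mult G v) (allFin n))

Adjacent : ∀ {n} → MGraph n → Fin n → Fin n → Set
Adjacent G u v = 1 ≤ mult G u v

ind : ∀ {n} → Fin n → Fin n → Fin n → Fin n → ℕ
ind a b x y with x ≟ a | y ≟ b | x ≟ b | y ≟ a
... | yes _ | yes _ | _     | _     = 1
... | _     | _     | yes _ | yes _ = 1
... | _     | _     | _     | _     = 0

-- G' arises from G by an admissible double edge swap (a1,a2)(a3,a4):
-- remove one edge of type {a1,a2} and one of type {a3,a4}, add edges of
-- types {a2,a3} and {a4,a1}; the removed edges share no endpoint and are
-- not both simple.
AdmSwap : ∀ {n} → MGraph n → MGraph n → Set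
AdmSwap {n} G G' =
  Σ (Fin n) λ a1 → Σ (Fin n) λ a2 → Σ (Fin n) λ a3 → Σ (Fin n) λ a4 →
    a1 ≢ a2 × a1 ≢ a3 × a1 ≢ a4 × a2 ≢ a3 × a2 ≢ a4 × a3 ≢ a4 ×
    1 ≤ mult G a1 a2 × 1 ≤ mult G a3 a4 ×
    (2 ≤ mult G a1 a2 ⊎ 2 ≤ mult G a3 a4) ×
    (∀ x y → mult G' x y + ind a1 a2 x y + ind a3 a4 x y
             ≡ mult G x y + ind a2 a3 x y + ind a4 a1 x y)

Reachable : ∀ {n} → MGraph n → MGraph n → Set
Reachable = Star AdmSwap

-- Order on types {x1,x2} (x1 > x2) written as pairs (x1 , x2):
-- (x1,x2) < (y1,y2) iff x1 < y1 or (x1 = y1 and x2 < y2); ≤ likewise.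
TypeLt : ∀ {n} → Fin n → Fin n → Fin n → Fin n → Set
TypeLt x1 x2 y1 y2 = x1 <ᶠ y1 ⊎ (x1 ≡ y1 × x2 <ᶠ y2)

TypeLe : ∀ {n} → Fin n → Fin n → Fin n → Fin n → Set
TypeLe x1 x2 y1 y2 = x1 <ᶠ y1 ⊎ (x1 ≡ y1 × x2 ≤ᶠ y2)

IsMaxNonSimple : ∀ {n} → MGraph n → Fin n → Fin n → Set
IsMaxNonSimple G u1 u2 =
  u2 <ᶠ u1 × 2 ≤ mult G u1 u2 ×
  (∀ x1 x2 → x2 <ᶠ x1 → 2 ≤ mult G x1 x2 → TypeLe x1 x2 u1 u2)

GraphLt : ∀ {n} → MGraph n → MGraph n → Set
GraphLt {n} G' G =
  Σ (Fin n) λ u1 → Σ (Fin n) λ u2 → IsMaxNonSimple G u1 u2 ×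
    ( (∀ x1 x2 → x2 <ᶠ x1 → 2 ≤ mult G' x1 x2 → TypeLt x1 x2 u1 u2)
    ⊎ (IsMaxNonSimple G' u1 u2 × mult G' u1 u2 < mult G u1 u2))

Ordinary : ∀ {n} → Fin n → Fin n → Fin n → Set
Ordinary u1 u2 v = v ≢ u1 × v ≢ u2

Small : ∀ {n} → Fin n → Fin n → Fin n → Set
Small u1 u2 v = Ordinary u1 u2 v × v <ᶠ u1

module Submission where

open import Defs
open import Data.Nat using (ℕ; _<_)
open import Data.Fin using (Fin) renaming (_<_ to _<ᶠ_)
open import Data.Product using (Σ; _×_)
open import Relation.Binary.PropositionalEquality using (_≡_)
open import Relation.Nullary using (¬_)

-- Suppose v has no small neighbour. If v < u2, the swap (u2,u1)(a,b), followed by (a,u1)(v,u2)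
-- when u1 and a were already adjacent, lowers the multiplicity of {u1,u2} without making any
-- type above {u1,u2} non-simple, contradicting irreducibility. If v > u2, the neighbours of v
-- are u1, u2 and large vertices; every large vertex is adjacent to u2 (otherwise a swap reduces
-- G, or its degree is below that of u1), and the edge u1v is simple, so deg v < deg u2,
-- contradicting u2 < v.

open import Data.Bool using (if_then_else_)
open import Data.Empty using (⊥; ⊥-elim)
open import Data.Fin using (zero; suc)
import Data.Fin.Properties as Fin
open import Data.List using (tabulate)
open import Data.List.Properties using (map-tabulate)
open import Data.Nat using (zero; suc; _+_; _∸_; _≤_; z≤n; s≤s)
import Data.Nat.Properties as ℕ
open import Algebra.Properties.CommutativeSemigroup ℕ.+-commutativeSemigroup using (interchange)
open import Data.Nat.ListAction using (sum)
open import Data.Nat.Solver using (module +-*-Solver)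
open +-*-Solver using (solve; _:+_; _:=_)
open import Data.Product using (_,_; proj₁; proj₂)
open import Data.Sum using (_⊎_; inj₁; inj₂)
open import Function using (_∘_)
open import Relation.Binary using (Tri; tri<; tri≈; tri>)
open import Relation.Binary.Construct.Closure.ReflexiveTransitive using (ε; _◅_)
open import Relation.Binary.PropositionalEquality using (_≢_; refl; trans; cong; subst; subst₂; ≢-sym)
  renaming (sym to ≡-sym)
open import Relation.Nullary using (Dec; yes; no; does; ¬?; _×-dec_)

m≤m+n+o : ∀ m n o → m ≤ m + n + o
m≤m+n+o m n o = ℕ.≤-trans (ℕ.m≤m+n m n) (ℕ.m≤m+n (m + n) o)

indicators-≤ : ∀ {m′ m i j k l : ℕ} → m′ + i + j ≡ m + k + l → k ≡ 0 → l ≡ 0 → m′ + i ≤ m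
indicators-≤ {m′} {m} {i} {j} eq refl refl = begin
  m′ + i     ≤⟨ ℕ.m≤m+n (m′ + i) j ⟩
  m′ + i + j ≡⟨ eq ⟩
  m + 0 + 0  ≡⟨ trans (ℕ.+-identityʳ (m + 0)) (ℕ.+-identityʳ m) ⟩
  m          ∎
  where open ℕ.≤-Reasoning

indicators-< : ∀ {m′ m i j k l : ℕ} → m′ + i + j ≡ m + k + l → i ≡ 1 → k ≡ 0 → l ≡ 0 → m′ < m
indicators-< {m′} {m} {j = j} eq refl refl refl = begin-strict
  m′         <⟨ ℕ.m<m+n m′ ℕ.0<1+n ⟩
  m′ + 1     ≤⟨ ℕ.m≤m+n (m′ + 1) j ⟩
  m′ + 1 + j ≡⟨ eq ⟩
  m + 0 + 0  ≡⟨ trans (ℕ.+-identityʳ (m + 0)) (ℕ.+-identityʳ m) ⟩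
  m          ∎
  where open ℕ.≤-Reasoning

∑ : ∀ {m} → (Fin m → ℕ) → ℕ
∑ f = sum (tabulate f)

deg≡∑ : ∀ {n} (G : MGraph n) v → deg G v ≡ ∑ (mult G v)
deg≡∑ G v = cong sum (map-tabulate (λ w → w) (mult G v))

∑-mono-≤ : ∀ {m} {f g : Fin m → ℕ} → (∀ w → f w ≤ g w) → ∑ f ≤ ∑ g
∑-mono-≤ {zero}  _   = z≤n
∑-mono-≤ {suc m} f≤g = ℕ.+-mono-≤ (f≤g zero) (∑-mono-≤ (f≤g ∘ suc))

∑-+ : ∀ {m} (f g : Fin m → ℕ) → ∑ (λ w → f w + g w) ≡ ∑ f + ∑ g
∑-+ {zero}  f g = refl
∑-+ {suc m} f g = trans (cong (f zero + g zero +_) (∑-+ (f ∘ suc) (g ∘ suc)))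
                        (interchange (f zero) (g zero) (∑ (f ∘ suc)) (∑ (g ∘ suc)))

∑-0 : ∀ m → ∑ {m} (λ _ → 0) ≡ 0
∑-0 zero    = refl
∑-0 (suc m) = ∑-0 m

δ : ∀ {m} → Fin m → ℕ → Fin m → ℕ
δ c k w = if does (w Fin.≟ c) then k else 0

∑-δ : ∀ {m} (c : Fin m) k → ∑ (δ c k) ≡ k
∑-δ {suc m} zero    k = trans (cong (k +_) (∑-0 m)) (ℕ.+-identityʳ k)
∑-δ {suc m} (suc c) k = ∑-δ c k

∑-+δ : ∀ {m} (f : Fin m → ℕ) c k → ∑ (λ w → f w + δ c k w) ≡ ∑ f + k
∑-+δ f c k = trans (∑-+ f (δ c k)) (cong (∑ f +_) (∑-δ c k))

∑-≤-+δ : ∀ {m} {f g : Fin m → ℕ} {c c′ k k′} →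
         (∀ w → f w + δ c k w ≤ g w + δ c′ k′ w) → ∑ f + k ≤ ∑ g + k′
∑-≤-+δ {f = f} {g} {c} {c′} {k} {k′} f≤g = subst₂ _≤_ (∑-+δ f c k) (∑-+δ g c′ k′) (∑-mono-≤ f≤g)

module _ {n : ℕ} where

  OfType : Fin n → Fin n → Fin n → Fin n → Set
  OfType a b x y = (x ≡ a × y ≡ b) ⊎ (x ≡ b × y ≡ a)

  ind-cases : ∀ a b x y → (ind a b x y ≡ 1 × OfType a b x y) ⊎ (ind a b x y ≡ 0 × ¬ OfType a b x y)
  ind-cases a b x y with x Fin.≟ a | y Fin.≟ b | x Fin.≟ b | y Fin.≟ a
  ... | yes p | yes q | _     | _     = inj₁ (refl , inj₁ (p , q))
  ... | yes _ | no _  | yes r | yes s = inj₁ (refl , inj₂ (r , s))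
  ... | no _  | _     | yes r | yes s = inj₁ (refl , inj₂ (r , s))
  ... | yes _ | no q  | yes _ | no s  = inj₂ (refl , λ { (inj₁ (_ , e)) → q e ; (inj₂ (_ , e)) → s e })
  ... | yes _ | no q  | no r  | _     = inj₂ (refl , λ { (inj₁ (_ , e)) → q e ; (inj₂ (e , _)) → r e })
  ... | no p  | _     | yes _ | no s  = inj₂ (refl , λ { (inj₁ (e , _)) → p e ; (inj₂ (_ , e)) → s e })
  ... | no p  | _     | no r  | _     = inj₂ (refl , λ { (inj₁ (e , _)) → p e ; (inj₂ (e , _)) → r e })

  ind-1 : ∀ {a b x y} → OfType a b x y → ind a b x y ≡ 1
  ind-1 {a} {b} {x} {y} t with ind-cases a b x y
  ... | inj₁ (i≡1 , _) = i≡1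
  ... | inj₂ (_ , ¬t)  = ⊥-elim (¬t t)

  ind-0 : ∀ {a b x y} → ¬ OfType a b x y → ind a b x y ≡ 0
  ind-0 {a} {b} {x} {y} ¬t with ind-cases a b x y
  ... | inj₁ (_ , t)   = ⊥-elim (¬t t)
  ... | inj₂ (i≡0 , _) = i≡0

  ind-0ˡ : ∀ {a b x y} → x ≢ a → x ≢ b → ind a b x y ≡ 0
  ind-0ˡ x≢a x≢b = ind-0 λ { (inj₁ (e , _)) → x≢a e ; (inj₂ (e , _)) → x≢b e }

  ind-0ʳ : ∀ {a b x y} → y ≢ a → y ≢ b → ind a b x y ≡ 0
  ind-0ʳ y≢a y≢b = ind-0 λ { (inj₁ (_ , e)) → y≢b e ; (inj₂ (_ , e)) → y≢a e }

  ind-cong : ∀ {a b x y a′ b′ x′ y′} → (OfType a b x y → OfType a′ b′ x′ y′) →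
             (OfType a′ b′ x′ y′ → OfType a b x y) → ind a b x y ≡ ind a′ b′ x′ y′
  ind-cong {a} {b} {x} {y} to from with ind-cases a b x y
  ... | inj₁ (i≡1 , t)  = trans i≡1 (≡-sym (ind-1 (to t)))
  ... | inj₂ (i≡0 , ¬t) = trans i≡0 (≡-sym (ind-0 (¬t ∘ from)))

  OfType-comm : ∀ {a b x y} → OfType a b x y → OfType a b y x
  OfType-comm (inj₁ (p , q)) = inj₂ (q , p)
  OfType-comm (inj₂ (p , q)) = inj₁ (q , p)

  OfType-flip : ∀ {a b x y} → OfType a b x y → OfType b a x y
  OfType-flip (inj₁ t) = inj₂ t
  OfType-flip (inj₂ t) = inj₁ t

  ind-comm : ∀ a b x y → ind a b x y ≡ ind a b y x
  ind-comm a b x y = ind-cong OfType-comm OfType-comm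

  ind-flip : ∀ a b x y → ind a b x y ≡ ind b a x y
  ind-flip a b x y = ind-cong OfType-flip OfType-flip

  ind-diag : ∀ {a b} x → a ≢ b → ind a b x x ≡ 0
  ind-diag x a≢b = ind-0 λ { (inj₁ (p , q)) → a≢b (trans (≡-sym p) q) ; (inj₂ (p , q)) → a≢b (trans (≡-sym q) p) }

  ind-disjoint : ∀ {a b c e x y} → OfType a b x y → c ≢ a → c ≢ b → e ≢ a → e ≢ b → ind c e x y ≡ 0
  ind-disjoint (inj₁ (refl , _)) c≢x _ e≢x _ = ind-0ˡ (≢-sym c≢x) (≢-sym e≢x)
  ind-disjoint (inj₂ (refl , _)) _ c≢x _ e≢x = ind-0ˡ (≢-sym c≢x) (≢-sym e≢x)

  OfType-mult : ∀ (G : MGraph n) {a b x y} → OfType a b x y → mult G x y ≡ mult G a b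
  OfType-mult G (inj₁ (refl , refl)) = refl
  OfType-mult G (inj₂ (refl , refl)) = sym G _ _

  TypeLe⇒≯ : ∀ {x1 x2 y1 y2 : Fin n} → TypeLe x1 x2 y1 y2 → ¬ TypeLt y1 y2 x1 x2
  TypeLe⇒≯ (inj₁ x1<y1)       (inj₁ y1<x1)       = Fin.<-asym x1<y1 y1<x1
  TypeLe⇒≯ (inj₁ x1<y1)       (inj₂ (refl , _))  = Fin.<-irrefl refl x1<y1
  TypeLe⇒≯ (inj₂ (refl , _))  (inj₁ y1<x1)       = Fin.<-irrefl refl y1<x1
  TypeLe⇒≯ (inj₂ (_ , x2≤y2)) (inj₂ (_ , y2<x2)) = ℕ.<⇒≱ y2<x2 x2≤y2

  TypeLt-cmp : ∀ (x1 x2 y1 y2 : Fin n) →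
               TypeLt x1 x2 y1 y2 ⊎ (x1 ≡ y1 × x2 ≡ y2) ⊎ TypeLt y1 y2 x1 x2
  TypeLt-cmp x1 x2 y1 y2 with Fin.<-cmp x1 y1
  ... | tri< x1<y1 _ _ = inj₁ (inj₁ x1<y1)
  ... | tri> _ _ y1<x1 = inj₂ (inj₂ (inj₁ y1<x1))
  ... | tri≈ _ refl _ with Fin.<-cmp x2 y2
  ...   | tri< x2<y2 _ _ = inj₁ (inj₂ (refl , x2<y2))
  ...   | tri≈ _ x2≡y2 _ = inj₂ (inj₁ (refl , x2≡y2))
  ...   | tri> _ _ y2<x2 = inj₂ (inj₂ (inj₂ (refl , y2<x2)))

  TypeLt⇒TypeLe : ∀ {x1 x2 y1 y2 : Fin n} → TypeLt x1 x2 y1 y2 → TypeLe x1 x2 y1 y2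
  TypeLt⇒TypeLe (inj₁ x1<y1)       = inj₁ x1<y1
  TypeLt⇒TypeLe (inj₂ (e , x2<y2)) = inj₂ (e , ℕ.<⇒≤ x2<y2)

  ind-0-above : ∀ {p q x1 x2 y1 y2} → TypeLt y1 y2 x1 x2 →
                TypeLe p q y1 y2 → TypeLe q p y1 y2 → ind p q x1 x2 ≡ 0
  ind-0-above {p} {q} {x1} {x2} above pq≤ qp≤ with ind-cases p q x1 x2
  ... | inj₂ (i≡0 , _)               = i≡0
  ... | inj₁ (_ , inj₁ (refl , refl)) = ⊥-elim (TypeLe⇒≯ pq≤ above)
  ... | inj₁ (_ , inj₂ (refl , refl)) = ⊥-elim (TypeLe⇒≯ qp≤ above)

adjacent⇒≢ : ∀ {n} (G : MGraph n) {x y} → Adjacent G x y → x ≢ y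
adjacent⇒≢ G {x} x~x refl = ℕ.<-irrefl (≡-sym (noloop G x)) x~x

module DoubleSwap {n : ℕ} (G : MGraph n) {a1 a2 a3 a4 : Fin n}
  (a1≢a2 : a1 ≢ a2) (a1≢a3 : a1 ≢ a3) (a1≢a4 : a1 ≢ a4)
  (a2≢a3 : a2 ≢ a3) (a2≢a4 : a2 ≢ a4) (a3≢a4 : a3 ≢ a4)
  (a1~a2 : Adjacent G a1 a2) (a3~a4 : Adjacent G a3 a4) where

  removed≤mult : ∀ x y → ind a1 a2 x y + ind a3 a4 x y ≤ mult G x y
  removed≤mult x y with ind-cases a1 a2 x y | ind-cases a3 a4 x y
  ... | inj₁ (i≡1 , t) | _ rewrite i≡1 | ind-disjoint t (≢-sym a1≢a3) (≢-sym a2≢a3) (≢-sym a1≢a4) (≢-sym a2≢a4) =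
    subst (1 ≤_) (≡-sym (OfType-mult G t)) a1~a2
  ... | inj₂ (i≡0 , _) | inj₁ (j≡1 , t) rewrite i≡0 | j≡1 = subst (1 ≤_) (≡-sym (OfType-mult G t)) a3~a4
  ... | inj₂ (i≡0 , _) | inj₂ (j≡0 , _) rewrite i≡0 | j≡0 = z≤n

  swapped : MGraph n
  swapped = record
    -- The truncated subtraction is exact by removed≤mult.
    { mult   = λ x y → mult G x y ∸ (ind a1 a2 x y + ind a3 a4 x y) + ind a2 a3 x y + ind a4 a1 x y
    ; sym    = symmetric
    ; noloop = loop-free
    }
    where
      symmetric : ∀ x y → mult G x y ∸ (ind a1 a2 x y + ind a3 a4 x y) + ind a2 a3 x y + ind a4 a1 x y
                        ≡ mult G y x ∸ (ind a1 a2 y x + ind a3 a4 y x) + ind a2 a3 y x + ind a4 a1 y x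
      symmetric x y rewrite sym G x y | ind-comm a1 a2 x y | ind-comm a3 a4 x y
                          | ind-comm a2 a3 x y | ind-comm a4 a1 x y = refl
      loop-free : ∀ x → mult G x x ∸ (ind a1 a2 x x + ind a3 a4 x x) + ind a2 a3 x x + ind a4 a1 x x ≡ 0
      loop-free x rewrite noloop G x | ind-diag x a1≢a2 | ind-diag x a3≢a4
                        | ind-diag x a2≢a3 | ind-diag x (≢-sym a1≢a4) = refl

  mult-swapped : ∀ x y → mult swapped x y + ind a1 a2 x y + ind a3 a4 x y
                       ≡ mult G x y + ind a2 a3 x y + ind a4 a1 x y
  mult-swapped x y = trans (rearrange (mult G x y ∸ (i + j)) k l i j)
                           (cong (λ m → m + k + l) (ℕ.m∸n+n≡m (removed≤mult x y)))
    where
      i = ind a1 a2 x y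
      j = ind a3 a4 x y
      k = ind a2 a3 x y
      l = ind a4 a1 x y
      rearrange : ∀ m k l i j → m + k + l + i + j ≡ m + (i + j) + k + l
      rearrange = solve 5 (λ m k l i j → m :+ k :+ l :+ i :+ j := m :+ (i :+ j) :+ k :+ l) refl

  swap-admissible : 2 ≤ mult G a1 a2 ⊎ 2 ≤ mult G a3 a4 → AdmSwap G swapped
  swap-admissible nonSimple =
    a1 , a2 , a3 , a4 , a1≢a2 , a1≢a3 , a1≢a4 , a2≢a3 , a2≢a4 , a3≢a4 , a1~a2 , a3~a4 , nonSimple , mult-swapped

  mult-swapped-≤ : ∀ x y → mult swapped x y ≤ mult G x y + ind a2 a3 x y + ind a4 a1 x y
  mult-swapped-≤ x y = subst (mult swapped x y ≤_) (mult-swapped x y) (m≤m+n+o _ _ _)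

  mult-swapped-≥ : ∀ {x y} → ind a1 a2 x y ≡ 0 → ind a3 a4 x y ≡ 0 → mult G x y ≤ mult swapped x y
  mult-swapped-≥ {x} {y} i≡0 j≡0 =
    ℕ.≤-trans (ℕ.m≤m+n (mult G x y) _) (indicators-≤ {m′ = mult G x y} {m = mult swapped x y} (≡-sym (mult-swapped x y)) i≡0 j≡0)

  mult-swapped-+-≤ : ∀ {x y} → ind a2 a3 x y ≡ 0 → ind a4 a1 x y ≡ 0 →
                     mult swapped x y + ind a1 a2 x y ≤ mult G x y
  mult-swapped-+-≤ {x} {y} = indicators-≤ {m′ = mult swapped x y} {m = mult G x y} (mult-swapped x y)

  mult-swapped-removed : mult swapped a1 a2 < mult G a1 a2
  mult-swapped-removed = indicators-< (mult-swapped a1 a2)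
    (ind-1 (inj₁ (refl , refl))) (ind-0ˡ a1≢a2 a1≢a3) (ind-0ʳ a2≢a4 (≢-sym a1≢a2))

  mult-swapped-added : mult G a2 a3 < mult swapped a2 a3
  mult-swapped-added = indicators-< (≡-sym (mult-swapped a2 a3))
    (ind-1 (inj₁ (refl , refl))) (ind-0ʳ (≢-sym a1≢a3) (≢-sym a2≢a3)) (ind-0ˡ a2≢a3 a2≢a4)

module MaxNonSimple {n : ℕ} (G : MGraph n) {u1 u2 : Fin n} (max : IsMaxNonSimple G u1 u2) where

  u2<u1 : u2 <ᶠ u1
  u2<u1 = proj₁ max

  u1≢u2 : u1 ≢ u2
  u1≢u2 = ≢-sym (Fin.<⇒≢ u2<u1)

  u2u1-nonSimple : 2 ≤ mult G u2 u1
  u2u1-nonSimple = subst (2 ≤_) (sym G u1 u2) (proj₁ (proj₂ max))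

  u2~u1 : Adjacent G u2 u1
  u2~u1 = ℕ.≤-trans (s≤s z≤n) u2u1-nonSimple

  above-simple : ∀ {x1 x2} → x2 <ᶠ x1 → TypeLt u1 u2 x1 x2 → mult G x1 x2 ≤ 1
  above-simple x2<x1 above =
    ℕ.≤-pred (ℕ.≰⇒> λ nonSimple → TypeLe⇒≯ (proj₂ (proj₂ max) _ _ x2<x1 nonSimple) above)

  large-simple : ∀ {x} → u1 <ᶠ x → ∀ y → mult G x y ≤ 1
  large-simple {x} u1<x y with Fin.<-cmp y x
  ... | tri< y<x _ _  = above-simple y<x (inj₁ u1<x)
  ... | tri≈ _ refl _ = ℕ.≤-trans (ℕ.≤-reflexive (noloop G x)) z≤n
  ... | tri> _ _ x<y  = subst (_≤ 1) (sym G y x) (above-simple x<y (inj₁ (Fin.<-trans u1<x x<y)))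

  u1-simple : ∀ {w} → u2 <ᶠ w → mult G u1 w ≤ 1
  u1-simple {w} u2<w with Fin.<-cmp w u1
  ... | tri< w<u1 _ _ = above-simple w<u1 (inj₂ (refl , u2<w))
  ... | tri≈ _ refl _ = ℕ.≤-trans (ℕ.≤-reflexive (noloop G w)) z≤n
  ... | tri> _ _ u1<w = subst (_≤ 1) (sym G w u1) (large-simple u1<w u1)

  GraphLt-intro : ∀ G′ → mult G′ u1 u2 < mult G u1 u2 →
                  (∀ x1 x2 → x2 <ᶠ x1 → TypeLt u1 u2 x1 x2 → mult G′ x1 x2 ≤ 1) → GraphLt G′ G
  GraphLt-intro G′ decreased simple-above = u1 , u2 , max , result
    where
      below-or-equal : ∀ x1 x2 → x2 <ᶠ x1 → 2 ≤ mult G′ x1 x2 → TypeLt x1 x2 u1 u2 ⊎ (x1 ≡ u1 × x2 ≡ u2)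
      below-or-equal x1 x2 x2<x1 nonSimple with TypeLt-cmp x1 x2 u1 u2
      ... | inj₁ below         = inj₁ below
      ... | inj₂ (inj₁ equal)  = inj₂ equal
      ... | inj₂ (inj₂ above) = ⊥-elim (ℕ.≤⇒≯ (simple-above x1 x2 x2<x1 above) nonSimple)
      result : (∀ x1 x2 → x2 <ᶠ x1 → 2 ≤ mult G′ x1 x2 → TypeLt x1 x2 u1 u2)
             ⊎ (IsMaxNonSimple G′ u1 u2 × mult G′ u1 u2 < mult G u1 u2)
      result with 2 ℕ.≤? mult G′ u1 u2
      ... | yes nonSimple = inj₂ ((u2<u1 , nonSimple , λ x1 x2 x2<x1 → weaken ∘ below-or-equal x1 x2 x2<x1) , decreased)
        where
          weaken : ∀ {x1 x2} → TypeLt x1 x2 u1 u2 ⊎ (x1 ≡ u1 × x2 ≡ u2) → TypeLe x1 x2 u1 u2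
          weaken (inj₁ below)          = TypeLt⇒TypeLe below
          weaken (inj₂ (refl , refl)) = inj₂ (refl , ℕ.≤-refl)
      ... | no simple = inj₁ λ x1 x2 x2<x1 nonSimple → strict nonSimple (below-or-equal x1 x2 x2<x1 nonSimple)
        where
          strict : ∀ {x1 x2} → 2 ≤ mult G′ x1 x2 → TypeLt x1 x2 u1 u2 ⊎ (x1 ≡ u1 × x2 ≡ u2) → TypeLt x1 x2 u1 u2
          strict _         (inj₁ below)          = below
          strict nonSimple (inj₂ (refl , refl)) = ⊥-elim (simple nonSimple)

  Harmless : Fin n → Fin n → Set
  Harmless x y = mult G x y ≡ 0 ⊎ (TypeLe x y u1 u2 × TypeLe y x u1 u2)

  harmless-bound : ∀ {x y x1 x2} → Harmless x y → x2 <ᶠ x1 → TypeLt u1 u2 x1 x2 →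
                   mult G x1 x2 + ind x y x1 x2 ≤ 1
  harmless-bound {x} {y} {x1} {x2} harmless x2<x1 above with ind-cases x y x1 x2 | harmless
  ... | inj₂ (i≡0 , _) | _ rewrite i≡0 | ℕ.+-identityʳ (mult G x1 x2) = above-simple x2<x1 above
  ... | inj₁ (i≡1 , t) | inj₁ xy≡0 rewrite i≡1 | OfType-mult G t | xy≡0 = ℕ.≤-refl
  ... | inj₁ (i≡1 , _) | inj₂ (xy≤ , yx≤) = ⊥-elim (ℕ.0≢1+n (trans (≡-sym (ind-0-above above xy≤ yx≤)) i≡1))

  module TwoSwaps {a b v : Fin n} (small-a : Small u1 u2 a) (small-b : Small u1 u2 b) (a~b : Adjacent G a b)
                  (u1~a : Adjacent G u1 a) (v<u2 : v <ᶠ u2) (u2~v : Adjacent G u2 v) (v≢a : v ≢ a) where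

    a≢u1 : a ≢ u1
    a≢u1 = proj₁ (proj₁ small-a)
    a≢u2 : a ≢ u2
    a≢u2 = proj₂ (proj₁ small-a)
    b≢u1 : b ≢ u1
    b≢u1 = proj₁ (proj₁ small-b)
    b≢u2 : b ≢ u2
    b≢u2 = proj₂ (proj₁ small-b)
    a<u1 : a <ᶠ u1
    a<u1 = proj₂ small-a
    b<u1 : b <ᶠ u1
    b<u1 = proj₂ small-b
    v<u1 : v <ᶠ u1
    v<u1 = Fin.<-trans v<u2 u2<u1
    v≢u1 : v ≢ u1
    v≢u1 = Fin.<⇒≢ v<u1
    v≢u2 : v ≢ u2
    v≢u2 = Fin.<⇒≢ v<u2

    module S₁ = DoubleSwap G (≢-sym u1≢u2) (≢-sym a≢u2) (≢-sym b≢u2) (≢-sym a≢u1) (≢-sym b≢u1)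
                           (adjacent⇒≢ G a~b) u2~u1 a~b

    G₁ : MGraph n
    G₁ = S₁.swapped

    au1-nonSimple : 2 ≤ mult G₁ a u1
    au1-nonSimple = subst (2 ≤_) (sym G₁ u1 a) (ℕ.≤-trans (s≤s u1~a) S₁.mult-swapped-added)

    v~u2 : Adjacent G₁ v u2
    v~u2 = ℕ.≤-trans (subst (1 ≤_) (sym G u2 v) u2~v)
                     (S₁.mult-swapped-≥ (ind-0ˡ v≢u2 v≢u1) (ind-0ʳ (≢-sym a≢u2) (≢-sym b≢u2)))

    module S₂ = DoubleSwap G₁ a≢u1 (≢-sym v≢a) a≢u2 (≢-sym v≢u1) u1≢u2 v≢u2
                           (ℕ.≤-trans (s≤s z≤n) au1-nonSimple) v~u2

    G₂ : MGraph n
    G₂ = S₂.swapped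


    first : AdmSwap G G₁
    first = S₁.swap-admissible (inj₁ u2u1-nonSimple)
    second : AdmSwap G₁ G₂
    second = S₂.swap-admissible (inj₁ au1-nonSimple)
    reachable : Reachable G G₂
    reachable = _◅_ {j = G₁} first (_◅_ {j = G₂} second ε)

    decreased : mult G₂ u1 u2 < mult G u1 u2
    decreased = begin-strict
      mult G₂ u1 u2                    ≤⟨ ℕ.m≤m+n _ _ ⟩
      mult G₂ u1 u2 + ind a u1 u1 u2   ≤⟨ S₂.mult-swapped-+-≤ (ind-0ʳ (≢-sym u1≢u2) (≢-sym v≢u2))
                                                             (ind-0ˡ u1≢u2 (≢-sym a≢u1)) ⟩
      mult G₁ u1 u2                    ≡⟨ sym G₁ u1 u2 ⟩
      mult G₁ u2 u1                    <⟨ S₁.mult-swapped-removed ⟩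
      mult G u2 u1                     ≡⟨ sym G u2 u1 ⟩
      mult G u1 u2                     ∎
      where open ℕ.≤-Reasoning

    simple-above : ∀ x1 x2 → x2 <ᶠ x1 → TypeLt u1 u2 x1 x2 → mult G₂ x1 x2 ≤ 1
    simple-above x1 x2 x2<x1 above =
      ℕ.≤-trans (ℕ.+-cancelʳ-≤ (ind a u1 x1 x2) _ _ round-trip) (above-simple x2<x1 above)
      where
        below : ∀ {p q} → p <ᶠ u1 → q <ᶠ u1 → ind p q x1 x2 ≡ 0
        below p<u1 q<u1 = ind-0-above above (inj₁ p<u1) (inj₁ q<u1)
        round-trip : mult G₂ x1 x2 + ind a u1 x1 x2 ≤ mult G x1 x2 + ind a u1 x1 x2
        round-trip = begin
          mult G₂ x1 x2 + ind a u1 x1 x2                    ≤⟨ S₂.mult-swapped-+-≤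
                                                                 (ind-0-above above (inj₂ (refl , ℕ.<⇒≤ v<u2)) (inj₁ v<u1))
                                                                 (below u2<u1 a<u1) ⟩
          mult G₁ x1 x2                                     ≤⟨ S₁.mult-swapped-≤ x1 x2 ⟩
          mult G x1 x2 + ind u1 a x1 x2 + ind b u2 x1 x2    ≡⟨ cong (_ +_) (below b<u1 u2<u1) ⟩
          mult G x1 x2 + ind u1 a x1 x2 + 0                 ≡⟨ ℕ.+-identityʳ _ ⟩
          mult G x1 x2 + ind u1 a x1 x2                     ≡⟨ cong (mult G x1 x2 +_) (ind-flip u1 a x1 x2) ⟩
          mult G x1 x2 + ind a u1 x1 x2                     ∎
          where open ℕ.≤-Reasoning

  module Irreducible (irreducible : ∀ G′ → Reachable G G′ → ¬ GraphLt G′ G)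
                     (deg-ordered : ∀ {x y} → deg G x < deg G y → x <ᶠ y) where

    ∑-ordered : ∀ {x y} → ∑ (mult G x) < ∑ (mult G y) → x <ᶠ y
    ∑-ordered {x} {y} = deg-ordered ∘ subst₂ _<_ (≡-sym (deg≡∑ G x)) (≡-sym (deg≡∑ G y))

    harmless-swap-absurd : ∀ {p q} → Ordinary u1 u2 p → Ordinary u1 u2 q → Adjacent G p q →
                           Harmless u1 p → Harmless q u2 → ⊥
    harmless-swap-absurd {p} {q} (p≢u1 , p≢u2) (q≢u1 , q≢u2) p~q u1p-harmless qu2-harmless =
      irreducible S.swapped (S.swap-admissible (inj₁ u2u1-nonSimple) ◅ ε)
        (GraphLt-intro S.swapped (subst₂ _<_ (sym S.swapped u2 u1) (sym G u2 u1) S.mult-swapped-removed) simple-above)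
      where
        p≢q : p ≢ q
        p≢q = adjacent⇒≢ G p~q
        module S = DoubleSwap G (≢-sym u1≢u2) (≢-sym p≢u2) (≢-sym q≢u2) (≢-sym p≢u1) (≢-sym q≢u1) p≢q u2~u1 p~q
        simple-above : ∀ x1 x2 → x2 <ᶠ x1 → TypeLt u1 u2 x1 x2 → mult S.swapped x1 x2 ≤ 1
        simple-above x1 x2 x2<x1 above with ind-cases q u2 x1 x2
        ... | inj₂ (j≡0 , _) = begin
          mult S.swapped x1 x2                                   ≤⟨ S.mult-swapped-≤ x1 x2 ⟩
          mult G x1 x2 + ind u1 p x1 x2 + ind q u2 x1 x2         ≡⟨ cong (_ +_) j≡0 ⟩
          mult G x1 x2 + ind u1 p x1 x2 + 0                      ≡⟨ ℕ.+-identityʳ _ ⟩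
          mult G x1 x2 + ind u1 p x1 x2                          ≤⟨ harmless-bound u1p-harmless x2<x1 above ⟩
          1                                                      ∎
          where open ℕ.≤-Reasoning
        ... | inj₁ (_ , t) = begin
          mult S.swapped x1 x2                                   ≤⟨ S.mult-swapped-≤ x1 x2 ⟩
          mult G x1 x2 + ind u1 p x1 x2 + ind q u2 x1 x2         ≡⟨ cong (λ i → mult G x1 x2 + i + _) i≡0 ⟩
          mult G x1 x2 + 0 + ind q u2 x1 x2                      ≡⟨ cong (_+ ind q u2 x1 x2) (ℕ.+-identityʳ (mult G x1 x2)) ⟩
          mult G x1 x2 + ind q u2 x1 x2                          ≤⟨ harmless-bound qu2-harmless x2<x1 above ⟩
          1                                                      ∎
          where
            open ℕ.≤-Reasoning
            i≡0 : ind u1 p x1 x2 ≡ 0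
            i≡0 = ind-disjoint t (≢-sym q≢u1) u1≢u2 p≢q p≢u2

    small-edge-absurd : ∀ {a b v} → Small u1 u2 a → Small u1 u2 b → Adjacent G a b →
                        v <ᶠ u2 → Adjacent G u2 v → v ≢ a → ⊥
    small-edge-absurd {a} small-a@(ordinary-a , _) small-b@(ordinary-b , b<u1) a~b v<u2 u2~v v≢a
      with mult G u1 a ℕ.≟ 0
    ... | yes u1a≡0 = harmless-swap-absurd ordinary-a ordinary-b a~b (inj₁ u1a≡0) (inj₂ (inj₁ b<u1 , inj₁ u2<u1))
    ... | no u1a≢0  = irreducible G₂ reachable (GraphLt-intro G₂ decreased simple-above)
      where open TwoSwaps small-a small-b a~b (ℕ.n≢0⇒n>0 u1a≢0) v<u2 u2~v v≢a

    large-adjacent-u2 : ∀ {y} → u1 <ᶠ y → Adjacent G u2 y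
    large-adjacent-u2 {y} u1<y with mult G u2 y ℕ.≟ 0
    ... | no u2y≢0  = ℕ.n≢0⇒n>0 u2y≢0
    ... | yes u2y≡0 = ⊥-elim (Fin.<-asym u1<y (∑-ordered (ℕ.+-cancelʳ-≤ 1 _ _ degrees)))
      where
        y≢u1 : y ≢ u1
        y≢u1 = ≢-sym (Fin.<⇒≢ u1<y)
        y≢u2 : y ≢ u2
        y≢u2 = ≢-sym (Fin.<⇒≢ (Fin.<-trans u2<u1 u1<y))
        yu2≡0 : mult G y u2 ≡ 0
        yu2≡0 = trans (sym G y u2) u2y≡0
        shared-neighbour : ∀ {w} → w ≢ u1 → w ≢ u2 → mult G y w ≤ mult G u1 w
        shared-neighbour {w} w≢u1 w≢u2 with mult G y w ℕ.≟ 0 | mult G u1 w ℕ.≟ 0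
        ... | yes yw≡0 | _         = ℕ.≤-trans (ℕ.≤-reflexive yw≡0) z≤n
        ... | no yw≢0  | yes u1w≡0 = ⊥-elim (harmless-swap-absurd (w≢u1 , w≢u2) (y≢u1 , y≢u2)
                                       (subst (1 ≤_) (sym G y w) (ℕ.n≢0⇒n>0 yw≢0)) (inj₁ u1w≡0) (inj₁ yu2≡0))
        ... | no _     | no u1w≢0  = ℕ.≤-trans (large-simple u1<y w) (ℕ.n≢0⇒n>0 u1w≢0)
        pointwise : ∀ w → mult G y w + δ u2 2 w ≤ mult G u1 w + δ u1 1 w
        pointwise w with w Fin.≟ u2 | w Fin.≟ u1
        ... | yes refl | _ rewrite yu2≡0 =
          ℕ.≤-trans u2u1-nonSimple (ℕ.≤-trans (ℕ.≤-reflexive (sym G u2 u1)) (ℕ.m≤m+n _ _))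
        ... | no _ | yes refl rewrite noloop G u1 | ℕ.+-identityʳ (mult G y u1) =
          large-simple u1<y u1
        ... | no w≢u2 | no w≢u1 =
          ℕ.+-monoˡ-≤ 0 (shared-neighbour w≢u1 w≢u2)
        degrees : suc (∑ (mult G y)) + 1 ≤ ∑ (mult G u1) + 1
        degrees = subst (_≤ ∑ (mult G u1) + 1) (ℕ.+-suc (∑ (mult G y)) 1) (∑-≤-+δ pointwise)

    small-above-u2-absurd : ∀ {v} → Small u1 u2 v → Adjacent G u2 v → u2 <ᶠ v →
                            (∀ w → Small u1 u2 w → ¬ Adjacent G v w) → ⊥
    small-above-u2-absurd {v} ((v≢u1 , v≢u2) , _) u2~v u2<v no-small-neighbour =
      Fin.<-asym u2<v (∑-ordered degrees)
      where
        q : ℕ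
        q = mult G v u2
        ordinary-neighbour : ∀ {w} → w ≢ u1 → w ≢ u2 → mult G v w ≤ mult G u2 w
        ordinary-neighbour {w} w≢u1 w≢u2 with Fin.<-cmp w u1
        ... | tri< w<u1 _ _ = ℕ.≤-trans (ℕ.≮⇒≥ (no-small-neighbour w ((w≢u1 , w≢u2) , w<u1))) z≤n
        ... | tri≈ _ w≡u1 _ = ⊥-elim (w≢u1 w≡u1)
        ... | tri> _ _ u1<w = ℕ.≤-trans (subst (_≤ 1) (sym G w v) (large-simple u1<w v)) (large-adjacent-u2 u1<w)
        -- The q edges between v and u2 are seen at u2 from v and at v from u2; the masses realign them.
        pointwise : ∀ w → mult G v w + δ u1 1 w + δ v q w ≤ mult G u2 w + δ u2 q w
        pointwise w with w Fin.≟ v | w Fin.≟ u2 | w Fin.≟ u1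
        ... | yes refl | yes v≡u2 | _        = ⊥-elim (v≢u2 v≡u2)
        ... | yes refl | no _     | yes v≡u1 = ⊥-elim (v≢u1 v≡u1)
        ... | yes refl | no _     | no _ rewrite noloop G v | ℕ.+-identityʳ (mult G u2 v) =
          ℕ.≤-reflexive (sym G v u2)
        ... | no _     | yes refl | yes u2≡u1 = ⊥-elim (u1≢u2 (≡-sym u2≡u1))
        ... | no _     | yes refl | no _ rewrite noloop G u2 | ℕ.+-identityʳ q | ℕ.+-identityʳ q = ℕ.≤-refl
        ... | no _     | no _     | yes refl rewrite ℕ.+-identityʳ (mult G v u1 + 1) | ℕ.+-identityʳ (mult G u2 u1) =
          ℕ.≤-trans (ℕ.+-monoˡ-≤ 1 (subst (_≤ 1) (sym G u1 v) (u1-simple u2<v))) u2u1-nonSimple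
        ... | no _     | no w≢u2  | no w≢u1 rewrite ℕ.+-identityʳ (mult G v w) =
          ℕ.+-monoˡ-≤ 0 (ordinary-neighbour w≢u1 w≢u2)
        degrees : ∑ (mult G v) < ∑ (mult G u2)
        degrees = subst (_≤ ∑ (mult G u2)) (trans (∑-+δ (mult G v) u1 1) (ℕ.+-comm _ 1))
                        (ℕ.+-cancelʳ-≤ q _ _ (∑-≤-+δ pointwise))

Small? : ∀ {n} (u1 u2 w : Fin n) → Dec (Small u1 u2 w)
Small? u1 u2 w = (¬? (w Fin.≟ u1) ×-dec ¬? (w Fin.≟ u2)) ×-dec (w Fin.<? u1)

lemma5p8 : (n : ℕ) (d : Fin n → ℕ)
    → (∀ u v → d u < d v → u <ᶠ v)
    → (G : MGraph n)
    → (∀ v → deg G v ≡ d v)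
    → (∀ G' → Reachable G G' → ¬ GraphLt G' G)
    → (u1 u2 : Fin n)
    → IsMaxNonSimple G u1 u2
    → (Σ (Fin n) λ a → Σ (Fin n) λ b → Small u1 u2 a × Small u1 u2 b × Adjacent G a b)
    → ∀ v → Small u1 u2 v → Adjacent G u2 v
    → Σ (Fin n) λ w → Small u1 u2 w × Adjacent G v w
lemma5p8 n d d-ordered G deg≡d irreducible u1 u2 max (a , b , small-a , small-b , a~b) v small-v u2~v
  with Fin.any? (λ w → Small? u1 u2 w ×-dec (1 ℕ.≤? mult G v w))
... | yes small-neighbour = small-neighbour
... | no none = ⊥-elim (absurd (Fin.<-cmp v u2))
  where
    open MaxNonSimple G max
    open Irreducible irreducible (λ {x} {y} → d-ordered x y ∘ subst₂ _<_ (deg≡d x) (deg≡d y))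
    no-small-neighbour : ∀ w → Small u1 u2 w → ¬ Adjacent G v w
    no-small-neighbour w small-w v~w = none (w , small-w , v~w)
    v≢a : v ≢ a
    v≢a v≡a = no-small-neighbour b small-b (subst (λ x → Adjacent G x b) (≡-sym v≡a) a~b)
    absurd : Tri (v <ᶠ u2) (v ≡ u2) (u2 <ᶠ v) → ⊥
    absurd (tri< v<u2 _ _) = small-edge-absurd small-a small-b a~b v<u2 u2~v v≢a
    absurd (tri≈ _ v≡u2 _) = proj₂ (proj₁ small-v) v≡u2
    absurd (tri> _ _ u2<v) = small-above-u2-absurd small-v u2~v u2<v no-small-neighbour
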